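{- Let $m,n,h\geq1$. The class $\mathcal{G}(m,h)$ is modally definable by $\{\Diamond^{m+1}p\to\Diamond^{\le m}p,\ B_h(m)\}$. If $n>m$, the class $\mathcal{F}(m,n,h)$ is modally definable by $\{\Diamond^np\to\Diamond^mp,\ B_h(n-1)\}$.
   Context: Modal formulas: variables, $\bot,\top$, Boolean connectives, unary $\Diamond$; $\Box\varphi=\neg\Diamond\neg\varphi$; $\Diamond^0\varphi=\varphi$, $\Diamond^{i+1}\varphi=\Diamond\Diamond^i\varphi$ (similarly $\Box^i$); $\Diamond^{\le m}\varphi=\bigvee_{i=0}^m\Diamond^i\varphi$, $\Box^{\le m}\varphi=\bigwedge_{i=0}^m\Box^i\varphi$. $B_1(m)=p_1\to\Box^{\le m}\Diamond^{\le m}p_1$, $B_{h+1}(m)=p_{h+1}\to\Box^{\le m}(\Diamond^{\le m}p_{h+1}\vee B_h(m))$. A class $\mathcal{C}$ of frames is modally definable by a set $\Phi$ of formulas if a frame belongs to $\mathcal{C}$ iff all formulas of $\Phi$ are valid in it (true at every point under every valuation, $\Diamond$ interpreted via the relation). $R^0$ identity, $R^{i+1}=R^i\circ R$, $R^*=\bigcup_iR^i$. $\mathcal{F}(m,n,h)$: frames with $R^n\subseteq R^m$ of height $\le h$; $\mathcal{G}(m,h)$: frames with $R^*=\bigcup_{0\le i\le m}R^i$ of height $\le h$; height is the maximal cardinality of a chain of clusters (classes of $xR^*y\wedge yR^*x$) ordered by $[x]\le[y]$ iff $xR^*y$. -}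

module Defs where

open import Level using (Level; 0ℓ)
open import Data.Nat using (ℕ; zero; suc; _≤_; _<_)
open import Data.Fin using (Fin; toℕ; inject₁) renaming (suc to fsuc)
open import Data.Product using (Σ; _×_; _,_)
open import Data.Sum using (_⊎_)
open import Data.Empty renaming (⊥ to Empty)
open import Data.Unit using (⊤; tt)
open import Relation.Nullary using (¬_)
open import Relation.Binary.PropositionalEquality using (_≡_)

infixr 4 _⇒_
infixr 5 _∨_
infixr 6 _∧_

data Fm : Set where
  var  : ℕ → Fm
  ⊥f   : Fm
  ⊤f   : Fm
  ~_   : Fm → Fm
  _∧_  : Fm → Fm → Fm
  _∨_  : Fm → Fm → Fm
  _⇒_  : Fm → Fm → Fm
  ◇    : Fm → Fm

□ : Fm → Fm
□ φ = ~ ◇ (~ φ)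

◇^ : ℕ → Fm → Fm
◇^ zero    φ = φ
◇^ (suc i) φ = ◇ (◇^ i φ)

□^ : ℕ → Fm → Fm
□^ zero    φ = φ
□^ (suc i) φ = □ (□^ i φ)

◇≤ : ℕ → Fm → Fm
◇≤ zero    φ = φ
◇≤ (suc m) φ = ◇≤ m φ ∨ ◇^ (suc m) φ

□≤ : ℕ → Fm → Fm
□≤ zero    φ = φ
□≤ (suc m) φ = □≤ m φ ∧ □^ (suc m) φ

-- the variable p is var 0 ; p_k is var k (k ≥ 1)
p : Fm
p = var 0

-- B h m  is  B_h(m)  for h ≥ 1 (B 0 m is an unused dummy value)
B : ℕ → ℕ → Fm
B zero          m = ⊤f
B (suc zero)    m = var 1 ⇒ □≤ m (◇≤ m (var 1))
B (suc (suc h)) m = var (suc (suc h)) ⇒ □≤ m (◇≤ m (var (suc (suc h))) ∨ B (suc h) m)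

record Frame : Set₁ where
  field
    W : Set
    R : W → W → Set

module _ (F : Frame) where
  open Frame F

  Valuation : Set₁
  Valuation = ℕ → W → Set

  ⟦_⟧ : Fm → Valuation → W → Set
  ⟦ var i ⟧ V x = V i x
  ⟦ ⊥f ⟧    V x = Empty
  ⟦ ⊤f ⟧    V x = ⊤
  ⟦ ~ φ ⟧   V x = ¬ ⟦ φ ⟧ V x
  ⟦ φ ∧ ψ ⟧ V x = ⟦ φ ⟧ V x × ⟦ ψ ⟧ V x
  ⟦ φ ∨ ψ ⟧ V x = ⟦ φ ⟧ V x ⊎ ⟦ ψ ⟧ V x
  ⟦ φ ⇒ ψ ⟧ V x = ⟦ φ ⟧ V x → ⟦ ψ ⟧ V x
  ⟦ ◇ φ ⟧   V x = Σ W λ y → R x y × ⟦ φ ⟧ V y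

  Valid : Fm → Set₁
  Valid φ = (V : Valuation) (x : W) → ⟦ φ ⟧ V x

  Rpow : ℕ → W → W → Set
  Rpow zero    x y = x ≡ y
  Rpow (suc i) x y = Σ W λ z → Rpow i x z × R z y

  R* : W → W → Set
  R* x y = Σ ℕ λ i → Rpow i x y

  -- a chain of k+1 distinct clusters [f 0] < [f 1] < ... < [f k]
  StrictChain : (k : ℕ) → (Fin (suc k) → W) → Set
  StrictChain k f = (i : Fin k) →
    R* (f (inject₁ i)) (f (fsuc i)) × ¬ R* (f (fsuc i)) (f (inject₁ i))

  HeightLe : ℕ → Set
  HeightLe h = ¬ (Σ (Fin (suc h) → W) λ f → StrictChain h f)

  PowIncl : ℕ → ℕ → Set
  PowIncl n m = ∀ x y → Rpow n x y → Rpow m x y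

  StarBounded : ℕ → Set
  StarBounded m =
    (∀ x y → R* x y → Σ ℕ λ i → i ≤ m × Rpow i x y) ×
    (∀ x y → (Σ ℕ λ i → i ≤ m × Rpow i x y) → R* x y)

InF : ℕ → ℕ → ℕ → Frame → Set
InF m n h F = PowIncl F n m × HeightLe F h

InG : ℕ → ℕ → Frame → Set
InG m h F = StarBounded F m × HeightLe F h

-- Both definability claims are instances of two facts. First, a formula ◇^n p → G p, with G
-- a "diamond" of some relation S, corresponds to R^n ⊆ S (take p true exactly at the
-- witness). Both side conditions make R* = R^{≤M} for M = m resp. n - 1, and on such frames
-- B_h(M) is valid iff the height is at most h: a refutation of B_{k+1}(M) at x climbs to a
-- point y with p_{k+1} true at x but not reachable from y, i.e. to a strictly higher
-- cluster where B_k(M) fails; conversely, along a strict chain x₀ < ... < x_h the valuation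
-- making p_{h-i} true on the down-set of xᵢ refutes B_h(M) at x₀.
module Submission where

open import Defs
open import Level using (0ℓ)
open import Axiom.ExcludedMiddle using (ExcludedMiddle)
open import Data.Nat using (ℕ; suc; _≤_; _<_; _+_; _∸_)
open import Data.Product using (_×_)
open import Function.Bundles using (_⇔_)

open import Data.Nat using (zero; z≤n; s≤s⁻¹)
open import Data.Nat.Properties using (m≤n⇒m<n∨m≡n; m≤n⇒m≤1+n; ≤-refl; ∸-cancelˡ-≡; +-comm)
open import Data.Fin using (Fin; toℕ) renaming (zero to fzero; suc to fsuc)
open import Data.Fin.Properties using (toℕ-injective; toℕ≤pred[n])
open import Data.Vec.Functional using (_∷_; tail)
open import Data.Product using (Σ; _,_; proj₁; proj₂)
open import Data.Sum using (inj₁; inj₂; [_,_])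
open import Data.Empty using (⊥-elim)
open import Function.Base using (_∘_)
open import Relation.Nullary using (¬_; yes; no)
open import Relation.Nullary.Decidable using (decidable-stable)
open import Relation.Binary.PropositionalEquality using (_≡_; refl; subst)
open import Function.Bundles using (mk⇔; Equivalence)
import Function.Properties.Equivalence as ⇔

⇔-×-dependent : ∀ {a a′ b b′} {A : Set a} {A′ : Set a′} {B : Set b} {B′ : Set b′} →
  A ⇔ A′ → (A → B ⇔ B′) → (A × B) ⇔ (A′ × B′)
⇔-×-dependent A⇔A′ B⇔B′ = mk⇔
  (λ (a , b) → Equivalence.to A⇔A′ a , Equivalence.to (B⇔B′ a) b)
  (λ (a′ , b′) → let a = Equivalence.from A⇔A′ a′ in a , Equivalence.from (B⇔B′ a) b′)

¬⇒-split : ExcludedMiddle 0ℓ → {A B : Set} → ¬ (A → B) → A × ¬ B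
¬⇒-split em {A} ¬a⇒b with em {A}
... | yes a = a , λ b → ¬a⇒b λ _ → b
... | no ¬a = ⊥-elim (¬a⇒b λ a → ⊥-elim (¬a a))

module _ (F : Frame) where
  open Frame F

  ⟦_⟧ᶠ : Fm → Valuation F → W → Set
  ⟦_⟧ᶠ = ⟦_⟧ F

  Reach≤ : ℕ → W → W → Set
  Reach≤ M x y = Σ ℕ λ i → i ≤ M × Rpow F i x y

  R*-refl : ∀ {x} → R* F x x
  R*-refl = 0 , refl

  Reach≤⇒R* : ∀ {M x y} → Reach≤ M x y → R* F x y
  Reach≤⇒R* (i , _ , q) = i , q

  Rpow-cons : ∀ i {x y z} → R x y → Rpow F i y z → Rpow F (suc i) x z
  Rpow-cons zero    r refl        = _ , refl , r
  Rpow-cons (suc i) r (w , q , r′) = w , Rpow-cons i r q , r′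

  Rpow-uncons : ∀ i {x z} → Rpow F (suc i) x z → Σ W λ y → R x y × Rpow F i y z
  Rpow-uncons zero    (_ , refl , r) = _ , r , refl
  Rpow-uncons (suc i) (w , q , r) with Rpow-uncons i q
  ... | y , rxy , q′ = y , rxy , (w , q′ , r)

  Rpow-trans : ∀ i j {x y z} → Rpow F i x y → Rpow F j y z → Rpow F (j + i) x z
  Rpow-trans i zero    q refl        = q
  Rpow-trans i (suc j) q (w , q′ , r) = w , Rpow-trans i j q q′ , r

  R*-trans : ∀ {x y z} → R* F x y → R* F y z → R* F x z
  R*-trans (i , q) (j , q′) = j + i , Rpow-trans i j q q′

  R*⊆Reach≤ : ∀ M → (∀ x y → Rpow F (suc M) x y → Reach≤ M x y) →
    ∀ x y → R* F x y → Reach≤ M x y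
  R*⊆Reach≤ M step x y (j , q) = go j q
    where
    go : ∀ {y} j → Rpow F j x y → Reach≤ M x y
    go zero    q           = 0 , z≤n , q
    go (suc j) (z , q , r) with go j q
    ... | i , i≤M , q′ with m≤n⇒m<n∨m≡n i≤M
    ...   | inj₁ i<M  = suc i , i<M , (z , q′ , r)
    ...   | inj₂ refl = step x _ (z , q′ , r)

  StarBounded⇔Rpow⊆Reach≤ : ∀ M →
    StarBounded F M ⇔ (∀ x y → Rpow F (suc M) x y → Reach≤ M x y)
  StarBounded⇔Rpow⊆Reach≤ M = mk⇔
    (λ (bounded , _) x y q → bounded x y (suc M , q))
    (λ step → R*⊆Reach≤ M step , λ x y (i , _ , q) → i , q)

  Represents : (Fm → Fm) → (W → W → Set) → Set₁
  Represents G S = ∀ φ V x → ⟦ G φ ⟧ᶠ V x ⇔ (Σ W λ y → S x y × ⟦ φ ⟧ᶠ V y)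

  ◇^-represents : ∀ i → Represents (◇^ i) (Rpow F i)
  ◇^-represents i φ V x = mk⇔ (elim i) (λ (y , q , s) → intro i q s)
    where
    elim : ∀ i {x} → ⟦ ◇^ i φ ⟧ᶠ V x → Σ W λ y → Rpow F i x y × ⟦ φ ⟧ᶠ V y
    elim zero    s           = _ , refl , s
    elim (suc i) (z , r , s) with elim i s
    ... | y , q , t = y , Rpow-cons i r q , t
    intro : ∀ i {x y} → Rpow F i x y → ⟦ φ ⟧ᶠ V y → ⟦ ◇^ i φ ⟧ᶠ V x
    intro zero    refl s = s
    intro (suc i) q    s with Rpow-uncons i q
    ... | z , r , q′ = z , r , intro i q′ s

  ◇≤-represents : ∀ M → Represents (◇≤ M) (Reach≤ M)
  ◇≤-represents M φ V x = mk⇔ (elim M) (λ (y , (i , i≤M , q) , s) → intro M i≤M q s)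
    where
    ◇^-intro : ∀ i {x y} → Rpow F i x y → ⟦ φ ⟧ᶠ V y → ⟦ ◇^ i φ ⟧ᶠ V x
    ◇^-intro i q s = Equivalence.from (◇^-represents i φ V _) (_ , q , s)
    elim : ∀ M {x} → ⟦ ◇≤ M φ ⟧ᶠ V x → Σ W λ y → Reach≤ M x y × ⟦ φ ⟧ᶠ V y
    elim zero    s        = _ , (0 , z≤n , refl) , s
    elim (suc M) (inj₁ s) with elim M s
    ... | y , (i , i≤M , q) , t = y , (i , m≤n⇒m≤1+n i≤M , q) , t
    elim (suc M) (inj₂ s) with Equivalence.to (◇^-represents (suc M) φ V _) s
    ... | y , q , t = y , (suc M , ≤-refl , q) , t
    intro : ∀ M {i x y} → i ≤ M → Rpow F i x y → ⟦ φ ⟧ᶠ V y → ⟦ ◇≤ M φ ⟧ᶠ V x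
    intro zero    z≤n  refl s = s
    intro (suc M) i≤1+M q s with m≤n⇒m<n∨m≡n i≤1+M
    ... | inj₁ i<1+M = inj₁ (intro M (s≤s⁻¹ i<1+M) q s)
    ... | inj₂ refl  = inj₂ (◇^-intro (suc M) q s)

  valid-◇⇒◇⇔⊆ : ∀ G G′ {S S′} → Represents G S → Represents G′ S′ →
    Valid F (G p ⇒ G′ p) ⇔ (∀ x y → S x y → S′ x y)
  valid-◇⇒◇⇔⊆ G G′ {S} {S′} rep rep′ = mk⇔ to from
    where
    to : Valid F (G p ⇒ G′ p) → ∀ x y → S x y → S′ x y
    to valid x y sxy
      with Equivalence.to (rep′ p V x) (valid V x (Equivalence.from (rep p V x) (y , sxy , refl)))
      where V = λ _ w → w ≡ y
    ... | _ , s′xy , refl = s′xy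
    from : (∀ x y → S x y → S′ x y) → Valid F (G p ⇒ G′ p)
    from S⊆S′ V x s with Equivalence.to (rep p V x) s
    ... | y , sxy , t = Equivalence.from (rep′ p V x) (y , S⊆S′ x y sxy , t)

  □≤-intro : ∀ M {φ V x} → (∀ y → Reach≤ M x y → ⟦ φ ⟧ᶠ V y) → ⟦ □≤ M φ ⟧ᶠ V x
  □≤-intro zero    all = all _ (0 , z≤n , refl)
  □≤-intro (suc M) {φ} {V} all =
    □≤-intro M (λ y (i , i≤M , q) → all y (i , m≤n⇒m≤1+n i≤M , q)) ,
    □^-intro (suc M) (λ y q → all y (suc M , ≤-refl , q))
    where
    □^-intro : ∀ i {x} → (∀ y → Rpow F i x y → ⟦ φ ⟧ᶠ V y) → ⟦ □^ i φ ⟧ᶠ V x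
    □^-intro zero    all           = all _ refl
    □^-intro (suc i) all (z , r , ¬s) = ¬s (□^-intro i (λ y q → all y (Rpow-cons i r q)))

  □≤-elim : ∀ M {φ V x y} → ⟦ □≤ M φ ⟧ᶠ V x → Reach≤ M x y → ¬ ¬ ⟦ φ ⟧ᶠ V y
  □≤-elim M {φ} {V} b (i , i≤M , q) = □^-elim i q (pick M i≤M b)
    where
    pick : ∀ M {i x} → i ≤ M → ⟦ □≤ M φ ⟧ᶠ V x → ⟦ □^ i φ ⟧ᶠ V x
    pick zero    z≤n    b        = b
    pick (suc M) i≤1+M (b , b′) with m≤n⇒m<n∨m≡n i≤1+M
    ... | inj₁ i<1+M = pick M (s≤s⁻¹ i<1+M) b
    ... | inj₂ refl  = b′
    □^-elim : ∀ i {x y} → Rpow F i x y → ⟦ □^ i φ ⟧ᶠ V x → ¬ ¬ ⟦ φ ⟧ᶠ V y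
    □^-elim zero    refl b ¬s = ¬s b
    □^-elim (suc i) q    b ¬s with Rpow-uncons i q
    ... | z , r , q′ = b (z , r , λ b′ → □^-elim i q′ b′ ¬s)

  ¬□≤⇒Reach≤¬ : ExcludedMiddle 0ℓ → ∀ M {φ V x} → ¬ ⟦ □≤ M φ ⟧ᶠ V x →
    Σ W λ y → Reach≤ M x y × ¬ ⟦ φ ⟧ᶠ V y
  ¬□≤⇒Reach≤¬ em M {φ} {V} {x} ¬b with em {Σ W λ y → Reach≤ M x y × ¬ ⟦ φ ⟧ᶠ V y}
  ... | yes counter = counter
  ... | no ¬counter = ⊥-elim (¬b (□≤-intro M λ y reach →
          decidable-stable em λ ¬s → ¬counter (y , reach , ¬s)))

  ◇≤-downset⇒R* : ∀ M {V j x y} → (∀ w → V j w → R* F w x) →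
    ⟦ ◇≤ M (var j) ⟧ᶠ V y → R* F y x
  ◇≤-downset⇒R* M down d with Equivalence.to (◇≤-represents M (var _) _ _) d
  ... | z , reach , vz = R*-trans (Reach≤⇒R* reach) (down z vz)

  -- Point i of a chain x₀ … xₙ witnesses variable n - i, which holds only below it; the
  -- top point gets p = var 0, which B does not mention.
  Marked : Valuation F → (n : ℕ) → (Fin (suc n) → W) → Set
  Marked V n f = ∀ i → V (n ∸ toℕ i) (f i) × (∀ w → V (n ∸ toℕ i) w → R* F w (f i))

  downsets : (n : ℕ) → (Fin (suc n) → W) → Valuation F
  downsets n f j w = Σ (Fin (suc n)) λ i → n ∸ toℕ i ≡ j × R* F w (f i)

  downsets-marked : ∀ n f → Marked (downsets n f) n f
  downsets-marked n f i = (i , refl , R*-refl) , λ { w (i′ , level≡ , w→fi′) →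
    subst (λ i → R* F w (f i))
      (toℕ-injective (∸-cancelˡ-≡ (toℕ≤pred[n] i′) (toℕ≤pred[n] i) level≡)) w→fi′ }

  module _ (M : ℕ) (bounded : ∀ x y → R* F x y → Reach≤ M x y) where

    ¬◇≤⇒¬R* : ∀ {φ V x y} → ⟦ φ ⟧ᶠ V x → ¬ ⟦ ◇≤ M φ ⟧ᶠ V y → ¬ R* F y x
    ¬◇≤⇒¬R* {φ} {V} s ¬d back =
      ¬d (Equivalence.from (◇≤-represents M φ V _) (_ , bounded _ _ back , s))

    refutation⇒chain : ExcludedMiddle 0ℓ → ∀ k V x → ¬ ⟦ B (suc k) M ⟧ᶠ V x →
      Σ (Fin (suc k) → W) λ t → StrictChain F (suc k) (x ∷ t)
    refutation⇒chain em zero V x ¬b with ¬⇒-split em ¬b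
    ... | v , ¬□ with ¬□≤⇒Reach≤¬ em M ¬□
    ...   | y , x→y , ¬d = (λ _ → y) , λ { fzero → Reach≤⇒R* x→y , ¬◇≤⇒¬R* v ¬d }
    refutation⇒chain em (suc k) V x ¬b with ¬⇒-split em ¬b
    ... | v , ¬□ with ¬□≤⇒Reach≤¬ em M ¬□
    ...   | y , x→y , ¬d∨b with refutation⇒chain em k V y (¬d∨b ∘ inj₂)
    ...     | t , chain = y ∷ t , λ { fzero    → Reach≤⇒R* x→y , ¬◇≤⇒¬R* v (¬d∨b ∘ inj₁)
                                    ; (fsuc i) → chain i }

    □≤-along-chain : ∀ {k f φ V} → StrictChain F (suc k) f →
      ⟦ □≤ M φ ⟧ᶠ V (f fzero) → ¬ ¬ ⟦ φ ⟧ᶠ V (f (fsuc fzero))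
    □≤-along-chain chain b = □≤-elim M b (bounded _ _ (proj₁ (chain fzero)))

    chain⇒¬◇≤ : ∀ {k f V} → StrictChain F (suc k) f → Marked V (suc k) f →
      ¬ ⟦ ◇≤ M (var (suc k)) ⟧ᶠ V (f (fsuc fzero))
    chain⇒¬◇≤ chain marked d = proj₂ (chain fzero) (◇≤-downset⇒R* M (proj₂ (marked fzero)) d)

    chain⇒refutation : ∀ k f V → StrictChain F (suc k) f → Marked V (suc k) f →
      ¬ ⟦ B (suc k) M ⟧ᶠ V (f fzero)
    chain⇒refutation zero    f V chain marked b =
      □≤-along-chain {f = f} chain (b (proj₁ (marked fzero))) (chain⇒¬◇≤ {f = f} chain marked)
    chain⇒refutation (suc k) f V chain marked b =
      □≤-along-chain {f = f} chain (b (proj₁ (marked fzero)))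
        [ chain⇒¬◇≤ {f = f} chain marked
        , chain⇒refutation k (tail f) V (chain ∘ fsuc) (marked ∘ fsuc) ]

    height≤⇔valid-B : ExcludedMiddle 0ℓ → ∀ k → HeightLe F (suc k) ⇔ Valid F (B (suc k) M)
    height≤⇔valid-B em k = mk⇔
      (λ height≤ V x → decidable-stable em λ ¬b →
        let t , chain = refutation⇒chain em k V x ¬b in height≤ (x ∷ t , chain))
      (λ valid (f , chain) → let V = downsets (suc k) f in
        chain⇒refutation k f V chain (downsets-marked (suc k) f) (valid V (f fzero)))

proposition12 : ExcludedMiddle 0ℓ → (m n h : ℕ) → 1 ≤ m → 1 ≤ n → 1 ≤ h →
    ((F : Frame) →
      (InG m h F ⇔ (Valid F (◇^ (m + 1) p ⇒ ◇≤ m p) × Valid F (B h m))))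
    × (m < n → (F : Frame) →
      (InF m n h F ⇔ (Valid F (◇^ n p ⇒ ◇^ m p) × Valid F (B h (n ∸ 1)))))
proposition12 em m zero    h       _ () _
proposition12 em m (suc n) zero    _ _ ()
proposition12 em m (suc n) (suc k) _ _ _ = G-definable , F-definable
  where
  G-definable : (F : Frame) →
    InG m (suc k) F ⇔ (Valid F (◇^ (m + 1) p ⇒ ◇≤ m p) × Valid F (B (suc k) m))
  G-definable F rewrite +-comm m 1 = ⇔-×-dependent
    (⇔.trans (StarBounded⇔Rpow⊆Reach≤ F m)
             (⇔.sym (valid-◇⇒◇⇔⊆ F (◇^ (suc m)) (◇≤ m)
                       (◇^-represents F (suc m)) (◇≤-represents F m))))
    (λ (bounded , _) → height≤⇔valid-B F m bounded em k)

  F-definable : m < suc n → (F : Frame) →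
    InF m (suc n) (suc k) F ⇔ (Valid F (◇^ (suc n) p ⇒ ◇^ m p) × Valid F (B (suc k) n))
  F-definable m<1+n F = ⇔-×-dependent
    (⇔.sym (valid-◇⇒◇⇔⊆ F (◇^ (suc n)) (◇^ m) (◇^-represents F (suc n)) (◇^-represents F m)))
    (λ incl → height≤⇔valid-B F n (R*⊆Reach≤ F n λ x y q → m , s≤s⁻¹ m<1+n , incl x y q) em k)
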